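{- Let $T$ be a tree with vertex set $V=\{1,\ldots,n\}$. For $x\le y$, define $x\in potBeg(y)$ iff every vertex of $\{x,\ldots,y\}$ lies in the connected component of $x$ in $T_{\ge x}$, and $y\in potEnd(x)$ iff every vertex of $\{x,\ldots,y\}$ lies in the connected component of $y$ in $T_{\le y}$. Then for all $1\le x\le y\le n$, the induced subgraph $T[\{x,\ldots,y\}]$ is connected if and only if $x\in potBeg(y)$ and $y\in potEnd(x)$.
   Context: $T_{\ge x}$ denotes the subgraph of $T$ induced by $\{x,x+1,\ldots,n\}$ and $T_{\le y}$ the subgraph induced by $\{1,\ldots,y\}$. -}

module Defs where

open import Level using (0ℓ)
open import Data.Nat using (ℕ; suc; _≥_)
open import Data.Fin using (Fin)
open import Data.Fin as F using ()
open import Data.List using (List; []; _∷_; length)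
open import Data.List.Relation.Unary.All using (All)
open import Data.List.Relation.Unary.Unique.Propositional using (Unique)
open import Data.Product using (Σ; _×_; ∃)
open import Relation.Nullary using (¬_)
open import Data.Unit using (⊤)
open import Relation.Binary.PropositionalEquality using (_≡_)

-- A finite simple graph on the vertex set Fin n
-- (vertex i : Fin n stands for the label toℕ i + 1 ∈ {1,…,n},
--  so the order on labels is the order on Fin n).
record Graph (n : ℕ) : Set₁ where
  field
    Adj    : Fin n → Fin n → Set
    sym    : ∀ {u v} → Adj u v → Adj v u
    irrefl : ∀ {u} → ¬ Adj u u
open Graph public

VSet : ℕ → Set₁
VSet n = Fin n → Set

data WalkIn {n : ℕ} (G : Graph n) (S : VSet n) : Fin n → Fin n → Set where
  here : ∀ {u} → S u → WalkIn G S u u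
  step : ∀ {u w v} → S u → Adj G u w → WalkIn G S w v → WalkIn G S u v

InducedConnected : ∀ {n} → Graph n → VSet n → Set
InducedConnected {n} G S =
  (Σ (Fin n) S) × (∀ u v → S u → S v → WalkIn G S u v)

data Chain {n : ℕ} (G : Graph n) : Fin n → List (Fin n) → Fin n → Set where
  end  : ∀ {u} → Chain G u [] u
  link : ∀ {u w v vs} → Adj G u w → Chain G w vs v → Chain G u (w ∷ vs) v

HasCycle : ∀ {n} → Graph n → Set
HasCycle {n} G =
  Σ (Fin n) λ v₀ → Σ (List (Fin n)) λ vs → Σ (Fin n) λ vk →
    length vs ≥ 2 × Unique (v₀ ∷ vs) × Chain G v₀ vs vk × Adj G vk v₀

Everything : ∀ {n} → VSet n
Everything _ = ⊤

IsTree : ∀ {n} → Graph n → Set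
IsTree G = InducedConnected G Everything × ¬ HasCycle G

Interval : ∀ {n} → Fin n → Fin n → VSet n
Interval x y v = x F.≤ v × v F.≤ y

AtLeast : ∀ {n} → Fin n → VSet n
AtLeast x v = x F.≤ v

AtMost : ∀ {n} → Fin n → VSet n
AtMost y v = v F.≤ y

InComponent : ∀ {n} → Graph n → VSet n → Fin n → Fin n → Set
InComponent G S c v = WalkIn G S c v

PotBeg : ∀ {n} → Graph n → Fin n → Fin n → Set
PotBeg T x y = ∀ v → Interval x y v → InComponent T (AtLeast x) x v

PotEnd : ∀ {n} → Graph n → Fin n → Fin n → Set
PotEnd T x y = ∀ v → Interval x y v → InComponent T (AtMost y) y v

-- In an acyclic graph two vertices are joined by at most one simple path,
-- so if a and b are joined both by a walk inside S₁ and by a walk inside S₂,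
-- the simple paths extracted from them coincide and give a walk inside
-- S₁ ∩ S₂.  The interval {x,…,y} is T_{≥x} ∩ T_{≤y}: potBeg provides walks
-- x → v in T_{≥x}, and potEnd provides walks x → y → v in T_{≤y}, so every v
-- of the interval is joined to x inside it.  The converse only enlarges the
-- vertex set of the walks.
module Submission where

open import Defs
open import Data.Nat using (ℕ; s≤s; z≤n; _≥_)
open import Data.Fin using (Fin; _≤_; _≟_)
open import Data.Fin.Properties using (≤-refl)
open import Data.Product using (_×_; _,_; proj₁; proj₂)
open import Data.List using (List; []; _∷_; length)
open import Data.List.Relation.Unary.All as All using (All; []; _∷_)
open import Data.List.Relation.Unary.All.Properties using (¬Any⇒All¬)
open import Data.List.Relation.Unary.AllPairs using ([]; _∷_)
open import Data.List.Relation.Unary.Any using (here; there)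
open import Data.List.Membership.Propositional using (_∈_)
open import Data.List.Relation.Unary.Unique.Propositional using (Unique)
open import Data.List.Relation.Unary.Unique.Propositional.Properties using (Unique[x∷xs]⇒x∉xs)
open import Data.Empty using (⊥-elim)
open import Function.Bundles using (_⇔_; mk⇔)
open import Relation.Nullary using (¬_; yes; no)
open import Relation.Unary using (_∩_; _⊆_)
open import Relation.Binary.PropositionalEquality using (_≡_; _≢_; refl; cong)

module WalkProperties {n : ℕ} (G : Graph n) where

  open import Data.List.Membership.DecPropositional (_≟_ {n}) using (_∈?_)

  private
    variable
      S S₁ S₂ : VSet n
      a b c u v w : Fin n
      vs ws : List (Fin n)

  headʷ : WalkIn G S a b → S a
  headʷ (here s)     = s
  headʷ (step s _ _) = s

  mapʷ : S₁ ⊆ S₂ → WalkIn G S₁ a b → WalkIn G S₂ a b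
  mapʷ f (here s)     = here (f s)
  mapʷ f (step s e W) = step (f s) e (mapʷ f W)

  infixr 5 _++ʷ_

  _++ʷ_ : WalkIn G S a b → WalkIn G S b c → WalkIn G S a c
  here _     ++ʷ W′ = W′
  step s e W ++ʷ W′ = step s e (W ++ʷ W′)

  reverseʷ : WalkIn G S a b → WalkIn G S b a
  reverseʷ (here s)     = here s
  reverseʷ (step s e W) = reverseʷ W ++ʷ step (headʷ W) (Graph.sym G e) (here s)

  chain⇒walk : Chain G a vs b → All S (a ∷ vs) → WalkIn G S a b
  chain⇒walk end          (s ∷ []) = here s
  chain⇒walk (link e ch) (s ∷ ss) = step s e (chain⇒walk ch ss)

  chain-end∈ : Chain G a vs b → b ∈ a ∷ vs
  chain-end∈ end         = here refl
  chain-end∈ (link _ ch) = there (chain-end∈ ch)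

  record SimplePath (S : VSet n) (a b : Fin n) : Set where
    constructor simplePath
    field
      {inner} : List (Fin n)
      chain   : Chain G a inner b
      unique  : Unique (a ∷ inner)
      inside  : All S (a ∷ inner)

  open SimplePath

  suffix : (p : SimplePath S w b) → a ∈ w ∷ inner p → SimplePath S a b
  suffix p                                         (here refl) = p
  suffix (simplePath end _ _)                      (there ())
  suffix (simplePath (link _ ch) (_ ∷ u) (_ ∷ s)) (there a∈)  = suffix (simplePath ch u s) a∈

  -- A walk is shortened by cutting out the closed subwalk at each repeated vertex.
  walk⇒simplePath : WalkIn G S a b → SimplePath S a b
  walk⇒simplePath (here s) = simplePath end ([] ∷ []) (s ∷ [])
  walk⇒simplePath {a = a} (step {w = w} s e W) with walk⇒simplePath W
  ... | p with a ∈? (w ∷ inner p)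
  ...   | yes a∈ = suffix p a∈
  ...   | no a∉  = simplePath (link e (chain p)) (¬Any⇒All¬ _ a∉ ∷ unique p) (s ∷ inside p)

  detour⇒cycle : Adj G u v → Adj G u w → v ≢ w → WalkIn G (u ≢_) v w → HasCycle G
  detour⇒cycle {u} {v} {w} uv uw v≢w W =
    u , v ∷ inner p , w , long (chain p) , inside p ∷ unique p ,
    link uv (chain p) , Graph.sym G uw
    where
    p = walk⇒simplePath W
    long : Chain G v vs w → length (v ∷ vs) ≥ 2
    long end        = ⊥-elim (v≢w refl)
    long (link _ _) = s≤s (s≤s z≤n)

  simplePath-unique : ¬ HasCycle G →
    Chain G a vs b → Unique (a ∷ vs) → Chain G a ws b → Unique (a ∷ ws) → vs ≡ ws
  simplePath-unique _ end _ end _ = refl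
  simplePath-unique _ end _ (link _ ch) u = ⊥-elim (Unique[x∷xs]⇒x∉xs u (chain-end∈ ch))
  simplePath-unique _ (link _ ch) u end _ = ⊥-elim (Unique[x∷xs]⇒x∉xs u (chain-end∈ ch))
  simplePath-unique acyclic (link {w = v} e₁ ch₁) (a∉₁ ∷ u₁) (link {w = w} e₂ ch₂) (a∉₂ ∷ u₂)
    with v ≟ w
  ... | yes refl = cong (v ∷_) (simplePath-unique acyclic ch₁ u₁ ch₂ u₂)
  ... | no v≢w   = ⊥-elim (acyclic (detour⇒cycle e₁ e₂ v≢w
                     (chain⇒walk ch₁ a∉₁ ++ʷ reverseʷ (chain⇒walk ch₂ a∉₂))))

  walk-∩ : ¬ HasCycle G → WalkIn G S₁ a b → WalkIn G S₂ a b → WalkIn G (S₁ ∩ S₂) a b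
  walk-∩ acyclic W₁ W₂ with walk⇒simplePath W₁ | walk⇒simplePath W₂
  ... | simplePath ch₁ u₁ s₁ | simplePath ch₂ u₂ s₂
    with simplePath-unique acyclic ch₁ u₁ ch₂ u₂
  ... | refl = chain⇒walk ch₁ (All.zip (s₁ , s₂))

mainTheorem5 : (n : ℕ) (T : Graph n) → IsTree T →
    (x y : Fin n) → x ≤ y →
    InducedConnected T (Interval x y) ⇔ (PotBeg T x y × PotEnd T x y)
mainTheorem5 n T (_ , acyclic) x y x≤y = mk⇔ toPot fromPot
  where
  open WalkProperties T

  x∈ : Interval x y x
  x∈ = ≤-refl , x≤y

  y∈ : Interval x y y
  y∈ = x≤y , ≤-refl

  toPot : InducedConnected T (Interval x y) → PotBeg T x y × PotEnd T x y
  toPot (_ , joined) = (λ v v∈ → mapʷ proj₁ (joined x v x∈ v∈))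
                     , (λ v v∈ → mapʷ proj₂ (joined y v y∈ v∈))

  fromPot : PotBeg T x y × PotEnd T x y → InducedConnected T (Interval x y)
  fromPot (potBeg , potEnd) = (x , x∈) , λ u v u∈ v∈ → reverseʷ (fromX u u∈) ++ʷ fromX v v∈
    where
    fromX : ∀ v → Interval x y v → WalkIn T (Interval x y) x v
    fromX v v∈ = walk-∩ acyclic (potBeg v v∈) (reverseʷ (potEnd x x∈) ++ʷ potEnd v v∈)
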